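{- Let $(K,\cdot,+,{}^{*},1,0,t,t')$ be a one-sorted Kleene algebra with tests and let $t(K)=\{x\in K\mid \exists y\in K.\ x=t(y)\}$. Then $t(K)$ contains $0$ and $1$, and is closed under $+$, $\cdot$ and $t'$.
   Context: A Kleene algebra is an idempotent semiring $(K,\cdot,+,1,0)$ with a unary operation ${}^{*}$ such that $1+xx^{*}\le x^{*}$, $1+x^{*}x\le x^{*}$, $y+xz\le z\Rightarrow x^{*}y\le z$, and $y+zx\le z\Rightarrow yx^{*}\le z$, where $x\le y$ iff $x+y=y$. A one-sorted Kleene algebra with tests (KAt) is a Kleene algebra expanded with two unary operations $t,t'$ such that for all $x,y$: $t(0)=0$; $t(1)=1$; $t(t(x)+t(y))=t(x)+t(y)$; $t(t(x)t(y))=t(x)t(y)$; $t(x)t(x)=t(x)$; $t(x)\le 1$; $1\le t'(t(x))+t(x)$; $t'(t(x))\,t(x)\le 0$; $t'(t(x))=t(t'(t(x)))$. -}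

module Defs where

open import Level using (Level; suc)
open import Relation.Binary.PropositionalEquality using (_≡_)
open import Data.Product using (Σ; ∃; _×_)

record KAt (a : Level) : Set (suc a) where
  infixl 6 _+_
  infixl 7 _·_
  infix 4 _≤_
  field
    K    : Set a
    _·_  : K → K → K
    _+_  : K → K → K
    _⋆   : K → K
    𝟏    : K
    𝟎    : K
    t    : K → K
    t'   : K → K

  _≤_ : K → K → Set a
  x ≤ y = x + y ≡ y

  field
    +-assoc  : ∀ x y z → (x + y) + z ≡ x + (y + z)
    +-comm   : ∀ x y → x + y ≡ y + x
    +-idem   : ∀ x → x + x ≡ x
    +-identʳ : ∀ x → x + 𝟎 ≡ x
    ·-assoc  : ∀ x y z → (x · y) · z ≡ x · (y · z)
    ·-identˡ : ∀ x → 𝟏 · x ≡ x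
    ·-identʳ : ∀ x → x · 𝟏 ≡ x
    distribˡ : ∀ x y z → x · (y + z) ≡ x · y + x · z
    distribʳ : ∀ x y z → (y + z) · x ≡ y · x + z · x
    zeroˡ    : ∀ x → 𝟎 · x ≡ 𝟎
    zeroʳ    : ∀ x → x · 𝟎 ≡ 𝟎
    star-unfoldˡ : ∀ x → 𝟏 + x · (x ⋆) ≤ x ⋆
    star-unfoldʳ : ∀ x → 𝟏 + (x ⋆) · x ≤ x ⋆
    star-indˡ    : ∀ x y z → y + x · z ≤ z → (x ⋆) · y ≤ z
    star-indʳ    : ∀ x y z → y + z · x ≤ z → y · (x ⋆) ≤ z
    t-0     : t 𝟎 ≡ 𝟎
    t-1     : t 𝟏 ≡ 𝟏
    t-+     : ∀ x y → t (t x + t y) ≡ t x + t y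
    t-·     : ∀ x y → t (t x · t y) ≡ t x · t y
    t-idem  : ∀ x → t x · t x ≡ t x
    t-≤1    : ∀ x → t x ≤ 𝟏
    t'-join : ∀ x → 𝟏 ≤ t' (t x) + t x
    t'-meet : ∀ x → t' (t x) · t x ≤ 𝟎
    t'-t    : ∀ x → t' (t x) ≡ t (t' (t x))

  InTK : K → Set a
  InTK x = ∃ λ y → x ≡ t y

module Submission where

open import Defs
open import Level using (Level)
open import Data.Product using (_×_; _,_)
open import Relation.Binary.PropositionalEquality using (refl; sym)

-- Every element of t(K) is literally of the form t u, and each test axiom
-- states that t fixes the corresponding combination of such elements.
module TestClosure {a : Level} (A : KAt a) where
  open KAt A

  InTK-𝟎 : InTK 𝟎
  InTK-𝟎 = 𝟎 , sym t-0

  InTK-𝟏 : InTK 𝟏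
  InTK-𝟏 = 𝟏 , sym t-1

  InTK-+ : ∀ x y → InTK x → InTK y → InTK (x + y)
  InTK-+ _ _ (u , refl) (v , refl) = t u + t v , sym (t-+ u v)

  InTK-· : ∀ x y → InTK x → InTK y → InTK (x · y)
  InTK-· _ _ (u , refl) (v , refl) = t u · t v , sym (t-· u v)

  InTK-t' : ∀ x → InTK x → InTK (t' x)
  InTK-t' _ (u , refl) = t' (t u) , t'-t u

mainTheorem2 : ∀ {a : Level} (A : KAt a) → let open KAt A in
    InTK 𝟎 × InTK 𝟏
      × (∀ x y → InTK x → InTK y → InTK (x + y))
      × (∀ x y → InTK x → InTK y → InTK (x · y))
      × (∀ x → InTK x → InTK (t' x))
mainTheorem2 A = InTK-𝟎 , InTK-𝟏 , InTK-+ , InTK-· , InTK-t'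
  where open TestClosure A
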